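{- (a) For every integer $m\ge 1$: among the values $t(n)$ for $0\le n< 4^m/2$, the value $0$ occurs exactly $2^{m-1}$ times, and for each $k$ with $1\le k<2^m$ the value $k$ occurs exactly $2^m-k$ times. (b) For every integer $m\ge 0$: among the values $t(n)$ for $0\le n<4^m$, the value $0$ occurs exactly $2^m-1$ times, the value $2^m$ occurs exactly once, and for each $k$ with $1\le k<2^m$ the value $k$ occurs exactly $2(2^m-k)$ times.
   Context: Let $(a(n))_{n\ge 0}$ be the Rudin-Shapiro sequence, defined by $a(0)=1$, $a(2n)=a(n)$, $a(2n+1)=(-1)^n a(n)$ for $n\ge 0$. Let $t(n)=\sum_{0\le i\le n}(-1)^i a(i)$. -}

module Defs where

open import Data.Nat using (ℕ; zero; suc; _+_; _*_; _∸_; _^_; _/_; _%_)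
open import Data.Integer as ℤ using (ℤ; +_)
open import Data.List using (List; length; filter; upTo)
open import Data.Integer.Properties using () renaming (_≟_ to _≟ℤ_)
open import Relation.Binary.PropositionalEquality using (_≡_)

sgn : ℕ → ℤ
sgn zero = + 1
sgn (suc n) = ℤ.- sgn n

-- Rudin-Shapiro with fuel: a(0)=1, a(2n)=a(n), a(2n+1)=(-1)^n a(n).
-- Fuel (suc n) suffices since n/2 < n for n ≥ 1.
rsFuel : ℕ → ℕ → ℤ
rsFuel zero n = + 1
rsFuel (suc f) zero = + 1
rsFuel (suc f) (suc n) with (suc n) % 2
... | zero = rsFuel f ((suc n) / 2)
... | suc _ = sgn ((suc n) / 2) ℤ.* rsFuel f ((suc n) / 2)

a : ℕ → ℤ
a n = rsFuel (suc n) n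

t : ℕ → ℤ
t zero = a 0
t (suc n) = t n ℤ.+ sgn (suc n) ℤ.* a (suc n)

count : ℕ → ℤ → ℕ
count N v = length (filter (λ n → t n ≟ℤ v) (upTo N))

-- Write x → y for the step of t from t(n - 1) to t(n), with t(-1) = 0, so that y = x ± 1.
-- The recurrences a(4n) = a(4n+1) = a(n), a(4n+2) = -a(4n+3) = (-1)^n a(n), together with
-- t(n - 1) ≡ n (mod 2), show that the four steps of t at 4n, …, 4n + 3 are determined by the
-- step at n: they form the walk 2x → 2x + ε → 2x → 2x + (y - x) → 2y with ε = (-1)^x (y - x).
-- Hence t is the fixed point of a substitution on the directed unit edges of ℕ. Each directed
-- edge occurs exactly twice in the images of the edges of its parent cell, so the number of
-- traversals of an edge during the first 4N steps is the sum of the traversals of its two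
-- preimages during the first N steps. By induction, during the first 4^m steps the edge leaving
-- v is traversed 2^m - v times, and during the first 2·4^m steps each edge with lower end w is
-- traversed 2^m - ⌈w/2⌉ times in each direction. The value k is taken once for each traversal
-- of an edge arriving at k, which gives the counts.

module Submission where

open import Defs
open import Algebra.Properties.CommutativeSemigroup using (interchange)
open import Data.Bool.Base using (true; false; if_then_else_)
open import Data.Integer.Base as ℤ using (ℤ; +_; -[1+_])
import Data.Integer.Properties as ℤ
open import Data.Integer.Solver using (module +-*-Solver)
open import Data.List.Base using ([]; _∷_; _++_; filter; length; upTo)
import Data.List.Properties as List
open import Data.Nat.Base
  using (ℕ; zero; suc; _+_; _*_; _∸_; _^_; _/_; _%_; _≤_; _<_; z≤n; s≤s; ⌊_/2⌋; ⌈_/2⌉; parity; NonZero)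
open import Data.Nat.DivMod
open import Data.Nat.Divisibility using (n∣m*n)
open import Data.Nat.Induction using (<-rec)
open import Data.Nat.Properties
open import Data.Parity.Base using (Parity; 0ℙ; 1ℙ)
import Data.Parity.Properties as ℙ
open import Data.Product.Base using (_×_; _,_; proj₁; proj₂)
open import Function.Base using (_∘_)
open import Relation.Nullary using (Dec; yes; no; does; ¬_)
open import Relation.Nullary.Decidable using (dec-true; dec-false)
open import Relation.Binary.PropositionalEquality
open ≡-Reasoning

χ : ∀ {A : Set} → Dec A → ℕ
χ a? = if does a? then 1 else 0

χ-yes : ∀ {A : Set} (a? : Dec A) → A → χ a? ≡ 1
χ-yes a? a rewrite dec-true a? a = refl

χ-no : ∀ {A : Set} (a? : Dec A) → ¬ A → χ a? ≡ 0
χ-no a? ¬a rewrite dec-false a? ¬a = refl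

∑< : ℕ → (ℕ → ℕ) → ℕ
∑< zero f = 0
∑< (suc n) f = ∑< n f + f n

∑<-cong : ∀ n {f g : ℕ → ℕ} → (∀ i → i < n → f i ≡ g i) → ∑< n f ≡ ∑< n g
∑<-cong zero eq = refl
∑<-cong (suc n) eq = cong₂ _+_ (∑<-cong n λ i i<n → eq i (m<n⇒m<1+n i<n)) (eq n ≤-refl)

∑<-+ : ∀ n (f g : ℕ → ℕ) → ∑< n (λ i → f i + g i) ≡ ∑< n f + ∑< n g
∑<-+ zero f g = refl
∑<-+ (suc n) f g = begin
  ∑< n (λ i → f i + g i) + (f n + g n) ≡⟨ cong (_+ (f n + g n)) (∑<-+ n f g) ⟩
  ∑< n f + ∑< n g + (f n + g n)         ≡⟨ interchange +-commutativeSemigroup (∑< n f) (∑< n g) (f n) (g n) ⟩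
  ∑< n f + f n + (∑< n g + g n)         ∎

∑<-*ˡ : ∀ n c (f : ℕ → ℕ) → ∑< n (λ i → c * f i) ≡ c * ∑< n f
∑<-*ˡ zero c f = sym (*-zeroʳ c)
∑<-*ˡ (suc n) c f = trans (cong (_+ c * f n) (∑<-*ˡ n c f)) (sym (*-distribˡ-+ c (∑< n f) (f n)))

∑<-++ : ∀ m n (f : ℕ → ℕ) → ∑< (n + m) f ≡ ∑< m f + ∑< n (λ j → f (j + m))
∑<-++ m zero f = sym (+-identityʳ (∑< m f))
∑<-++ m (suc n) f = trans (cong (_+ f (n + m)) (∑<-++ m n f)) (+-assoc (∑< m f) _ _)

∑<-blocks : ∀ N k (f : ℕ → ℕ) → ∑< (N * k) f ≡ ∑< N (λ q → ∑< k (λ j → f (j + q * k)))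
∑<-blocks zero k f = refl
∑<-blocks (suc N) k f = trans (∑<-++ (N * k) k f) (cong (_+ ∑< k (λ j → f (j + N * k))) (∑<-blocks N k f))

+≡*2 : ∀ n → n + n ≡ n * 2
+≡*2 n = trans (cong (λ m → n + m) (sym (+-identityʳ n))) (*-comm 2 n)

*4≡*2*2 : ∀ n → n * 4 ≡ n * 2 * 2
*4≡*2*2 n = sym (*-assoc n 2 2)

[j+qk]/k≡q : ∀ {j} q k .{{_ : NonZero k}} → j < k → (j + q * k) / k ≡ q
[j+qk]/k≡q {j} q k j<k = trans (+-distrib-/-∣ʳ j (n∣m*n q)) (cong₂ _+_ (m<n⇒m/n≡0 j<k) (m*n/n≡m q k))

[j+qk]%k≡j : ∀ {j} q k .{{_ : NonZero k}} → j < k → (j + q * k) % k ≡ j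
[j+qk]%k≡j {j} q k j<k = trans ([m+kn]%n≡m%n j q k) (m<n⇒m%n≡m j<k)

sgn-*2 : ∀ n → sgn (n * 2) ≡ + 1
sgn-*2 zero = refl
sgn-*2 (suc n) = trans (ℤ.neg-involutive (sgn (n * 2))) (sgn-*2 n)

sgn-+*2 : ∀ k n → sgn (k + n * 2) ≡ sgn k
sgn-+*2 zero n = sgn-*2 n
sgn-+*2 (suc k) n = cong ℤ.-_ (sgn-+*2 k n)

sgn-cancel : ∀ n x → sgn n ℤ.* (sgn n ℤ.* x) ≡ x
sgn-cancel zero x = trans (ℤ.*-identityˡ _) (ℤ.*-identityˡ x)
sgn-cancel (suc n) x = trans (negate-twice (sgn n) x) (sgn-cancel n x)
  where
  open +-*-Solver
  negate-twice : ∀ s x → ℤ.- s ℤ.* (ℤ.- s ℤ.* x) ≡ s ℤ.* (s ℤ.* x)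
  negate-twice = solve 2 (λ s x → :- s :* (:- s :* x) := s :* (s :* x)) refl

rsStep : ℕ → ℕ → ℤ → ℤ
rsStep zero m x = x
rsStep (suc _) m x = sgn m ℤ.* x

rsFuel-suc : ∀ f n → rsFuel (suc f) (suc n) ≡ rsStep (suc n % 2) (suc n / 2) (rsFuel f (suc n / 2))
rsFuel-suc f n with suc n % 2
... | zero = refl
... | suc _ = refl

half< : ∀ n → suc n / 2 < suc n
half< n = m/n<m (suc n) 2 (s≤s (s≤s z≤n))

rsFuel-stable : ∀ f g n → n < f → n < g → rsFuel f n ≡ rsFuel g n
rsFuel-stable (suc f) (suc g) zero _ _ = refl
rsFuel-stable (suc f) (suc g) (suc n) (s≤s n<f) (s≤s n<g) = begin
  rsFuel (suc f) (suc n)                            ≡⟨ rsFuel-suc f n ⟩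
  rsStep (suc n % 2) (suc n / 2) (rsFuel f (suc n / 2))
    ≡⟨ cong (rsStep (suc n % 2) (suc n / 2)) (rsFuel-stable f g _ (<-≤-trans (half< n) n<f) (<-≤-trans (half< n) n<g)) ⟩
  rsStep (suc n % 2) (suc n / 2) (rsFuel g (suc n / 2)) ≡⟨ rsFuel-suc g n ⟨
  rsFuel (suc g) (suc n)                            ∎

a-suc : ∀ n → a (suc n) ≡ rsStep (suc n % 2) (suc n / 2) (a (suc n / 2))
a-suc n = trans (rsFuel-suc (suc n) n) (cong (rsStep (suc n % 2) (suc n / 2)) (rsFuel-stable _ _ _ (half< n) (n<1+n _)))

a-even : ∀ n → a (n * 2) ≡ a n
a-even zero = refl
a-even (suc n) = trans (a-suc (suc (n * 2)))
  (cong₂ (λ b m → rsStep b m (a m)) ([j+qk]%k≡j (suc n) 2 (s≤s z≤n)) ([j+qk]/k≡q (suc n) 2 (s≤s z≤n)))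

a-odd : ∀ n → a (1 + n * 2) ≡ sgn n ℤ.* a n
a-odd n = trans (a-suc (n * 2))
  (cong₂ (λ b m → rsStep b m (a m)) ([j+qk]%k≡j n 2 (s≤s (s≤s z≤n))) ([j+qk]/k≡q n 2 (s≤s (s≤s z≤n))))

tPrev : ℕ → ℤ
tPrev zero = + 0
tPrev (suc n) = t n

Δt : ℕ → ℤ
Δt n = sgn n ℤ.* a n

t≡tPrev+Δt : ∀ n → t n ≡ tPrev n ℤ.+ Δt n
t≡tPrev+Δt zero = refl
t≡tPrev+Δt (suc n) = refl

Δt-4n : ∀ n → Δt (n * 4) ≡ a n
Δt-4n n = begin
  Δt (n * 4)                     ≡⟨ cong Δt (*4≡*2*2 n) ⟩
  sgn (n * 2 * 2) ℤ.* a (n * 2 * 2) ≡⟨ cong₂ ℤ._*_ (sgn-*2 (n * 2)) (trans (a-even (n * 2)) (a-even n)) ⟩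
  + 1 ℤ.* a n                    ≡⟨ ℤ.*-identityˡ (a n) ⟩
  a n                            ∎

Δt-4n+1 : ∀ n → Δt (1 + n * 4) ≡ ℤ.- a n
Δt-4n+1 n = begin
  Δt (1 + n * 4)                         ≡⟨ cong (λ m → Δt (1 + m)) (*4≡*2*2 n) ⟩
  ℤ.- sgn (n * 2 * 2) ℤ.* a (1 + n * 2 * 2) ≡⟨ cong₂ (λ s x → ℤ.- s ℤ.* x) (sgn-*2 (n * 2)) (a-odd (n * 2)) ⟩
  ℤ.- + 1 ℤ.* (sgn (n * 2) ℤ.* a (n * 2))   ≡⟨ cong (λ x → ℤ.- + 1 ℤ.* x) (cong₂ ℤ._*_ (sgn-*2 n) (a-even n)) ⟩
  ℤ.- + 1 ℤ.* (+ 1 ℤ.* a n)                 ≡⟨ cong (ℤ.- + 1 ℤ.*_) (ℤ.*-identityˡ (a n)) ⟩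
  ℤ.- + 1 ℤ.* a n                           ≡⟨ ℤ.-1*i≡-i (a n) ⟩
  ℤ.- a n                                   ∎

Δt-4n+2 : ∀ n → Δt (2 + n * 4) ≡ Δt n
Δt-4n+2 n = begin
  Δt (2 + n * 4)                    ≡⟨ cong (λ m → Δt (2 + m)) (*4≡*2*2 n) ⟩
  Δt ((1 + n * 2) * 2)              ≡⟨ cong₂ ℤ._*_ (sgn-+*2 2 (n * 2)) (trans (a-even (1 + n * 2)) (a-odd n)) ⟩
  + 1 ℤ.* Δt n                      ≡⟨ ℤ.*-identityˡ (Δt n) ⟩
  Δt n                              ∎

Δt-4n+3 : ∀ n → Δt (3 + n * 4) ≡ Δt n
Δt-4n+3 n = begin
  Δt (3 + n * 4)                    ≡⟨ cong (λ m → Δt (3 + m)) (*4≡*2*2 n) ⟩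
  Δt (1 + (1 + n * 2) * 2)          ≡⟨ cong₂ ℤ._*_ (sgn-+*2 3 (n * 2)) (a-odd (1 + n * 2)) ⟩
  ℤ.- + 1 ℤ.* (ℤ.- sgn (n * 2) ℤ.* a (1 + n * 2))
    ≡⟨ cong (λ x → ℤ.- + 1 ℤ.* (ℤ.- x ℤ.* a (1 + n * 2))) (sgn-*2 n) ⟩
  ℤ.- + 1 ℤ.* (ℤ.- + 1 ℤ.* a (1 + n * 2)) ≡⟨ sgn-cancel 1 (a (1 + n * 2)) ⟩
  a (1 + n * 2)                     ≡⟨ a-odd n ⟩
  Δt n                              ∎

tPrev-4n : ∀ n → tPrev (n * 4) ≡ tPrev n ℤ.+ tPrev n
tPrev-4n zero = refl
tPrev-4n (suc n) = begin
  t (n * 4) ℤ.+ Δt (1 + n * 4) ℤ.+ Δt (2 + n * 4) ℤ.+ Δt (3 + n * 4)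
    ≡⟨ cong₂ ℤ._+_ (cong₂ ℤ._+_ (cong₂ ℤ._+_ (trans (t≡tPrev+Δt (n * 4)) (cong₂ ℤ._+_ (tPrev-4n n) (Δt-4n n)))
                                              (Δt-4n+1 n))
                                (Δt-4n+2 n))
                   (Δt-4n+3 n) ⟩
  tPrev n ℤ.+ tPrev n ℤ.+ a n ℤ.+ ℤ.- a n ℤ.+ Δt n ℤ.+ Δt n
    ≡⟨ solve 3 (λ P A D → P :+ P :+ A :+ :- A :+ D :+ D := (P :+ D) :+ (P :+ D)) refl (tPrev n) (a n) (Δt n) ⟩
  (tPrev n ℤ.+ Δt n) ℤ.+ (tPrev n ℤ.+ Δt n) ≡⟨ cong₂ ℤ._+_ (t≡tPrev+Δt n) (t≡tPrev+Δt n) ⟨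
  t n ℤ.+ t n                                ∎
  where open +-*-Solver

data Dir : Set where
  up down : Dir

_≟ᵈ_ : (d d′ : Dir) → Dec (d ≡ d′)
up ≟ᵈ up = yes refl
up ≟ᵈ down = no λ ()
down ≟ᵈ up = no λ ()
down ≟ᵈ down = yes refl

data Shape : Set where
  shape : Parity → Dir → Shape

-- edge s (shape p d) joins 2s + p and 2s + p + 1 and is traversed upwards or downwards according to d.
data Edge : Set where
  edge : ℕ → Shape → Edge

bit : Parity → ℕ
bit 0ℙ = 0
bit 1ℙ = 1

low : Edge → ℕ
low (edge s (shape p _)) = bit p + s * 2

dir : Edge → Dir
dir (edge _ (shape _ d)) = d

source target : Edge → ℕ
source e@(edge _ (shape _ up)) = low e
source e@(edge _ (shape _ down)) = suc (low e)
target e@(edge _ (shape _ up)) = suc (low e)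
target e@(edge _ (shape _ down)) = low e

Δ : Edge → ℤ
Δ (edge _ (shape _ up)) = + 1
Δ (edge _ (shape _ down)) = -[1+ 0 ]

target≡source+Δ : ∀ e → + target e ≡ + source e ℤ.+ Δ e
target≡source+Δ (edge _ (shape _ up)) = cong +_ (+-comm 1 _)
target≡source+Δ (edge _ (shape _ down)) = refl

sgn-target : ∀ e → sgn (target e) ≡ ℤ.- sgn (source e)
sgn-target (edge _ (shape _ up)) = refl
sgn-target e@(edge _ (shape _ down)) = sym (ℤ.neg-involutive (sgn (low e)))

sgn-source : ∀ s h → sgn (source (edge s h)) ≡ sgn (source (edge 0 h))
sgn-source s (shape p up) = trans (sgn-+*2 (bit p) s) (sym (sgn-+*2 (bit p) 0))
sgn-source s (shape p down) = trans (sgn-+*2 (suc (bit p)) s) (sym (sgn-+*2 (suc (bit p)) 0))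

parity-bit+*2 : ∀ p s → parity (bit p + s * 2) ≡ p
parity-bit+*2 0ℙ zero = refl
parity-bit+*2 1ℙ zero = refl
parity-bit+*2 0ℙ (suc s) = parity-bit+*2 0ℙ s
parity-bit+*2 1ℙ (suc s) = parity-bit+*2 1ℙ s

⌊bit+*2/2⌋ : ∀ p s → ⌊ bit p + s * 2 /2⌋ ≡ s
⌊bit+*2/2⌋ 0ℙ zero = refl
⌊bit+*2/2⌋ 1ℙ zero = refl
⌊bit+*2/2⌋ 0ℙ (suc s) = cong suc (⌊bit+*2/2⌋ 0ℙ s)
⌊bit+*2/2⌋ 1ℙ (suc s) = cong suc (⌊bit+*2/2⌋ 1ℙ s)

bit+*2-injective : ∀ p s p′ s′ → bit p + s * 2 ≡ bit p′ + s′ * 2 → p ≡ p′ × s ≡ s′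
bit+*2-injective p s p′ s′ eq =
  trans (sym (parity-bit+*2 p s)) (trans (cong parity eq) (parity-bit+*2 p′ s′)) ,
  trans (sym (⌊bit+*2/2⌋ p s)) (trans (cong ⌊_/2⌋ eq) (⌊bit+*2/2⌋ p′ s′))

bit-parity+⌊/2⌋*2 : ∀ w → bit (parity w) + ⌊ w /2⌋ * 2 ≡ w
bit-parity+⌊/2⌋*2 zero = refl
bit-parity+⌊/2⌋*2 (suc zero) = refl
bit-parity+⌊/2⌋*2 (suc (suc w)) =
  trans (+-suc _ _) (cong suc (trans (+-suc _ _) (cong suc (bit-parity+⌊/2⌋*2 w))))

bit-parity+⌊/2⌋ : ∀ w → bit (parity w) + ⌊ w /2⌋ ≡ ⌈ w /2⌉
bit-parity+⌊/2⌋ zero = refl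
bit-parity+⌊/2⌋ (suc zero) = refl
bit-parity+⌊/2⌋ (suc (suc w)) = trans (+-suc _ _) (cong suc (bit-parity+⌊/2⌋ w))

data Slot : Set where
  slot : Parity → Shape → Slot

place : ℕ → Slot → Edge
place s (slot c h) = edge (bit c + s * 2) h

-- The walk 2x → 2x + ε → 2x → 2x + u → 2y, with ε = (-1)^x u, that replaces a step x → y = x + u,
-- listed for the four edges of cell 0 (the last clause of each block is index 3). The fine edges
-- lie in cell c ∈ {0, 1} of the doubled line; place s shifts them to the refinement of cell s.
subdivide : Shape → ℕ → Slot
subdivide (shape 0ℙ up) 0 = slot 0ℙ (shape 0ℙ up)
subdivide (shape 0ℙ up) 1 = slot 0ℙ (shape 0ℙ down)
subdivide (shape 0ℙ up) 2 = slot 0ℙ (shape 0ℙ up)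
subdivide (shape 0ℙ up) _ = slot 0ℙ (shape 1ℙ up)
subdivide (shape 1ℙ up) 0 = slot 0ℙ (shape 1ℙ down)
subdivide (shape 1ℙ up) 1 = slot 0ℙ (shape 1ℙ up)
subdivide (shape 1ℙ up) 2 = slot 1ℙ (shape 0ℙ up)
subdivide (shape 1ℙ up) _ = slot 1ℙ (shape 1ℙ up)
subdivide (shape 0ℙ down) 0 = slot 1ℙ (shape 0ℙ up)
subdivide (shape 0ℙ down) 1 = slot 1ℙ (shape 0ℙ down)
subdivide (shape 0ℙ down) 2 = slot 0ℙ (shape 1ℙ down)
subdivide (shape 0ℙ down) _ = slot 0ℙ (shape 0ℙ down)
subdivide (shape 1ℙ down) 0 = slot 1ℙ (shape 1ℙ down)
subdivide (shape 1ℙ down) 1 = slot 1ℙ (shape 1ℙ up)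
subdivide (shape 1ℙ down) 2 = slot 1ℙ (shape 1ℙ down)
subdivide (shape 1ℙ down) _ = slot 1ℙ (shape 0ℙ down)

refine : Edge → ℕ → Edge
refine (edge s h) j = place s (subdivide h j)

source-refine₀ : ∀ e → source (refine e 0) ≡ source e * 2
source-refine₀ (edge s (shape 0ℙ up)) = refl
source-refine₀ (edge s (shape 1ℙ up)) = refl
source-refine₀ (edge s (shape 0ℙ down)) = refl
source-refine₀ (edge s (shape 1ℙ down)) = refl

refine-connected : ∀ e j → j < 3 → target (refine e j) ≡ source (refine e (suc j))
refine-connected (edge s (shape 0ℙ up)) 0 _ = refl
refine-connected (edge s (shape 0ℙ up)) 1 _ = refl
refine-connected (edge s (shape 0ℙ up)) 2 _ = refl
refine-connected (edge s (shape 1ℙ up)) 0 _ = refl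
refine-connected (edge s (shape 1ℙ up)) 1 _ = refl
refine-connected (edge s (shape 1ℙ up)) 2 _ = refl
refine-connected (edge s (shape 0ℙ down)) 0 _ = refl
refine-connected (edge s (shape 0ℙ down)) 1 _ = refl
refine-connected (edge s (shape 0ℙ down)) 2 _ = refl
refine-connected (edge s (shape 1ℙ down)) 0 _ = refl
refine-connected (edge s (shape 1ℙ down)) 1 _ = refl
refine-connected (edge s (shape 1ℙ down)) 2 _ = refl
refine-connected _ (suc (suc (suc _))) (s≤s (s≤s (s≤s ())))

refine-Δ₀ : ∀ e → Δ (refine e 0) ≡ sgn (source e) ℤ.* Δ e
refine-Δ₀ (edge s h) = trans (cell₀ h) (cong (ℤ._* Δ (edge s h)) (sym (sgn-source s h)))
  where
  cell₀ : ∀ h → Δ (refine (edge s h) 0) ≡ sgn (source (edge 0 h)) ℤ.* Δ (edge s h)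
  cell₀ (shape 0ℙ up) = refl
  cell₀ (shape 1ℙ up) = refl
  cell₀ (shape 0ℙ down) = refl
  cell₀ (shape 1ℙ down) = refl

refine-Δ₁ : ∀ e → Δ (refine e 1) ≡ ℤ.- Δ (refine e 0)
refine-Δ₁ (edge s (shape 0ℙ up)) = refl
refine-Δ₁ (edge s (shape 1ℙ up)) = refl
refine-Δ₁ (edge s (shape 0ℙ down)) = refl
refine-Δ₁ (edge s (shape 1ℙ down)) = refl

refine-Δ₂ : ∀ e → Δ (refine e 2) ≡ Δ e
refine-Δ₂ (edge s (shape 0ℙ up)) = refl
refine-Δ₂ (edge s (shape 1ℙ up)) = refl
refine-Δ₂ (edge s (shape 0ℙ down)) = refl
refine-Δ₂ (edge s (shape 1ℙ down)) = refl

refine-Δ₃ : ∀ e → Δ (refine e 3) ≡ Δ e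
refine-Δ₃ (edge s (shape 0ℙ up)) = refl
refine-Δ₃ (edge s (shape 1ℙ up)) = refl
refine-Δ₃ (edge s (shape 0ℙ down)) = refl
refine-Δ₃ (edge s (shape 1ℙ down)) = refl

stepWithin : ℕ → ℕ → Edge
stepWithin zero _ = edge 0 (shape 0ℙ up)
stepWithin (suc f) n = refine (stepWithin f (n / 4)) (n % 4)

step : ℕ → Edge
step n = stepWithin n n

stepWithin-0 : ∀ f → stepWithin f 0 ≡ edge 0 (shape 0ℙ up)
stepWithin-0 zero = refl
stepWithin-0 (suc f) = cong (λ e → refine e 0) (stepWithin-0 f)

n≤1+f⇒n/4≤f : ∀ n f → n ≤ suc f → n / 4 ≤ f
n≤1+f⇒n/4≤f zero f _ = z≤n
n≤1+f⇒n/4≤f (suc n) f (s≤s n≤f) = ≤-trans (<⇒≤pred (m/n<m (suc n) 4 (s≤s (s≤s z≤n)))) n≤f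

stepWithin-stable : ∀ f g n → n ≤ f → n ≤ g → stepWithin f n ≡ stepWithin g n
stepWithin-stable zero g zero _ _ = sym (stepWithin-0 g)
stepWithin-stable (suc f) zero zero _ _ = stepWithin-0 (suc f)
stepWithin-stable (suc f) (suc g) n n≤f n≤g = cong (λ e → refine e (n % 4))
  (stepWithin-stable f g (n / 4) (n≤1+f⇒n/4≤f n f n≤f) (n≤1+f⇒n/4≤f n g n≤g))

step-unfold : ∀ n → step n ≡ refine (step (n / 4)) (n % 4)
step-unfold n = trans (stepWithin-stable n (suc n) n ≤-refl (n≤1+n n))
  (cong (λ e → refine e (n % 4)) (stepWithin-stable n (n / 4) (n / 4) (m/n≤m n 4) ≤-refl))

step-block : ∀ q j → j < 4 → step (j + q * 4) ≡ refine (step q) j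
step-block q j j<4 = trans (step-unfold (j + q * 4))
  (cong₂ (λ m i → refine (step m) i) ([j+qk]/k≡q q 4 j<4) ([j+qk]%k≡j q 4 j<4))

record Tracks (n : ℕ) (e : Edge) : Set where
  field
    tPrev≡source : tPrev n ≡ + source e
    sgn≡sgn-source : sgn n ≡ sgn (source e)
    Δt≡Δ : Δt n ≡ Δ e
open Tracks

t≡target : ∀ {n e} → Tracks n e → t n ≡ + target e
t≡target {n} {e} T = begin
  t n                        ≡⟨ t≡tPrev+Δt n ⟩
  tPrev n ℤ.+ Δt n           ≡⟨ cong₂ ℤ._+_ (tPrev≡source T) (Δt≡Δ T) ⟩
  + source e ℤ.+ Δ e         ≡⟨ target≡source+Δ e ⟨
  + target e                 ∎

tracks-suc : ∀ {n e e′} → Tracks n e → target e ≡ source e′ → Δt (suc n) ≡ Δ e′ → Tracks (suc n) e′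
tracks-suc {n} {e} T e→e′ Δt≡Δe′ = record
  { tPrev≡source = trans (t≡target T) (cong +_ e→e′)
  ; sgn≡sgn-source = trans (cong ℤ.-_ (sgn≡sgn-source T)) (trans (sym (sgn-target e)) (cong sgn e→e′))
  ; Δt≡Δ = Δt≡Δe′
  }

a≡Δ-refine₀ : ∀ {q e} → Tracks q e → a q ≡ Δ (refine e 0)
a≡Δ-refine₀ {q} {e} T = begin
  a q                       ≡⟨ sgn-cancel q (a q) ⟨
  sgn q ℤ.* Δt q            ≡⟨ cong₂ ℤ._*_ (sgn≡sgn-source T) (Δt≡Δ T) ⟩
  sgn (source e) ℤ.* Δ e    ≡⟨ refine-Δ₀ e ⟨
  Δ (refine e 0)            ∎

tracks-4n : ∀ {q e} → Tracks q e → Tracks (q * 4) (refine e 0)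
tracks-4n {q} {e} T = record
  { tPrev≡source = begin
      tPrev (q * 4)              ≡⟨ tPrev-4n q ⟩
      tPrev q ℤ.+ tPrev q        ≡⟨ cong₂ ℤ._+_ (tPrev≡source T) (tPrev≡source T) ⟩
      + (source e + source e)    ≡⟨ cong +_ (trans (+≡*2 (source e)) (sym (source-refine₀ e))) ⟩
      + source (refine e 0)      ∎
  ; sgn≡sgn-source = begin
      sgn (q * 4)                ≡⟨ cong sgn (*4≡*2*2 q) ⟩
      sgn (q * 2 * 2)            ≡⟨ sgn-*2 (q * 2) ⟩
      + 1                        ≡⟨ sgn-*2 (source e) ⟨
      sgn (source e * 2)         ≡⟨ cong sgn (source-refine₀ e) ⟨
      sgn (source (refine e 0))  ∎
  ; Δt≡Δ = trans (Δt-4n q) (a≡Δ-refine₀ T)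
  }

tracks-refine : ∀ {q e} → Tracks q e → ∀ j → j < 4 → Tracks (j + q * 4) (refine e j)
tracks-refine {q} {e} T = λ where
    0 _ → T₀
    1 _ → T₁
    2 _ → T₂
    3 _ → T₃
    (suc (suc (suc (suc _)))) (s≤s (s≤s (s≤s (s≤s ()))))
  where
  T₀ = tracks-4n T
  T₁ = tracks-suc T₀ (refine-connected e 0 (s≤s z≤n))
    (trans (Δt-4n+1 q) (trans (cong ℤ.-_ (a≡Δ-refine₀ T)) (sym (refine-Δ₁ e))))
  T₂ = tracks-suc T₁ (refine-connected e 1 (s≤s (s≤s z≤n)))
    (trans (Δt-4n+2 q) (trans (Δt≡Δ T) (sym (refine-Δ₂ e))))
  T₃ = tracks-suc T₂ (refine-connected e 2 (s≤s (s≤s (s≤s z≤n))))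
    (trans (Δt-4n+3 q) (trans (Δt≡Δ T) (sym (refine-Δ₃ e))))

tracks : ∀ n → Tracks n (step n)
tracks = <-rec (λ n → Tracks n (step n)) go
  where
  go : ∀ n → (∀ {m} → m < n → Tracks m (step m)) → Tracks n (step n)
  go zero _ = record { tPrev≡source = refl ; sgn≡sgn-source = refl ; Δt≡Δ = refl }
  go n@(suc _) rec = subst (λ m → Tracks m (step m)) (sym (m≡m%n+[m/n]*n n 4))
    (subst (Tracks (n % 4 + n / 4 * 4)) (sym (step-block (n / 4) (n % 4) (m%n<n n 4)))
      (tracks-refine (rec (m/n<m n 4 (s≤s (s≤s z≤n)))) (n % 4) (m%n<n n 4)))

t≡target-step : ∀ n → t n ≡ + target (step n)
t≡target-step n = t≡target (tracks n)

δ : ℕ → ℕ → ℕ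
δ m n = χ (m ≟ n)

δʰ : Shape → Shape → ℕ
δʰ (shape p d) (shape p′ d′) = χ (p ℙ.≟ p′) * χ (d ≟ᵈ d′)

δˢ : Slot → Slot → ℕ
δˢ (slot c h) (slot c′ h′) = χ (c ℙ.≟ c′) * δʰ h h′

δᵉ : Edge → Edge → ℕ
δᵉ (edge s h) (edge s′ h′) = δ s s′ * δʰ h h′

δ-bit+*2 : ∀ p s p′ s′ → δ (bit p + s * 2) (bit p′ + s′ * 2) ≡ δ s s′ * χ (p ℙ.≟ p′)
δ-bit+*2 p s p′ s′ with s ≟ s′ | p ℙ.≟ p′
... | yes refl | yes refl =
  trans (χ-yes (bit p + s * 2 ≟ bit p + s * 2) refl) (cong (_* 1) (sym (χ-yes (s ≟ s) refl)))
... | yes _ | no p≢p′ =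
  trans (χ-no (bit p + s * 2 ≟ bit p′ + s′ * 2) (p≢p′ ∘ proj₁ ∘ bit+*2-injective p s p′ s′))
        (sym (*-zeroʳ (δ s s′)))
... | no s≢s′ | p≟p′ =
  trans (χ-no (bit p + s * 2 ≟ bit p′ + s′ * 2) (s≢s′ ∘ proj₂ ∘ bit+*2-injective p s p′ s′))
        (cong (_* χ p≟p′) (sym (χ-no (s ≟ s′) s≢s′)))

δᵉ-place : ∀ s r σ σ′ → δᵉ (place s σ) (place r σ′) ≡ δ s r * δˢ σ σ′
δᵉ-place s r (slot c h) (slot c′ h′) =
  trans (cong (_* δʰ h h′) (δ-bit+*2 c s c′ r)) (*-assoc (δ s r) (χ (c ℙ.≟ c′)) (δʰ h h′))

parents : Slot → Shape × Shape
parents (slot 0ℙ (shape 0ℙ up)) = shape 0ℙ up , shape 0ℙ up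
parents (slot 0ℙ (shape 0ℙ down)) = shape 0ℙ up , shape 0ℙ down
parents (slot 0ℙ (shape 1ℙ up)) = shape 0ℙ up , shape 1ℙ up
parents (slot 0ℙ (shape 1ℙ down)) = shape 1ℙ up , shape 0ℙ down
parents (slot 1ℙ (shape 0ℙ up)) = shape 1ℙ up , shape 0ℙ down
parents (slot 1ℙ (shape 0ℙ down)) = shape 0ℙ down , shape 1ℙ down
parents (slot 1ℙ (shape 1ℙ up)) = shape 1ℙ up , shape 1ℙ down
parents (slot 1ℙ (shape 1ℙ down)) = shape 1ℙ down , shape 1ℙ down

subdivide-multiplicity : ∀ h σ → ∑< 4 (λ j → δˢ (subdivide h j) σ) ≡ δʰ h (proj₁ (parents σ)) + δʰ h (proj₂ (parents σ))
subdivide-multiplicity (shape 0ℙ up) (slot 0ℙ (shape 0ℙ up)) = refl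
subdivide-multiplicity (shape 0ℙ up) (slot 0ℙ (shape 0ℙ down)) = refl
subdivide-multiplicity (shape 0ℙ up) (slot 0ℙ (shape 1ℙ up)) = refl
subdivide-multiplicity (shape 0ℙ up) (slot 0ℙ (shape 1ℙ down)) = refl
subdivide-multiplicity (shape 0ℙ up) (slot 1ℙ (shape 0ℙ up)) = refl
subdivide-multiplicity (shape 0ℙ up) (slot 1ℙ (shape 0ℙ down)) = refl
subdivide-multiplicity (shape 0ℙ up) (slot 1ℙ (shape 1ℙ up)) = refl
subdivide-multiplicity (shape 0ℙ up) (slot 1ℙ (shape 1ℙ down)) = refl
subdivide-multiplicity (shape 0ℙ down) (slot 0ℙ (shape 0ℙ up)) = refl
subdivide-multiplicity (shape 0ℙ down) (slot 0ℙ (shape 0ℙ down)) = refl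
subdivide-multiplicity (shape 0ℙ down) (slot 0ℙ (shape 1ℙ up)) = refl
subdivide-multiplicity (shape 0ℙ down) (slot 0ℙ (shape 1ℙ down)) = refl
subdivide-multiplicity (shape 0ℙ down) (slot 1ℙ (shape 0ℙ up)) = refl
subdivide-multiplicity (shape 0ℙ down) (slot 1ℙ (shape 0ℙ down)) = refl
subdivide-multiplicity (shape 0ℙ down) (slot 1ℙ (shape 1ℙ up)) = refl
subdivide-multiplicity (shape 0ℙ down) (slot 1ℙ (shape 1ℙ down)) = refl
subdivide-multiplicity (shape 1ℙ up) (slot 0ℙ (shape 0ℙ up)) = refl
subdivide-multiplicity (shape 1ℙ up) (slot 0ℙ (shape 0ℙ down)) = refl
subdivide-multiplicity (shape 1ℙ up) (slot 0ℙ (shape 1ℙ up)) = refl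
subdivide-multiplicity (shape 1ℙ up) (slot 0ℙ (shape 1ℙ down)) = refl
subdivide-multiplicity (shape 1ℙ up) (slot 1ℙ (shape 0ℙ up)) = refl
subdivide-multiplicity (shape 1ℙ up) (slot 1ℙ (shape 0ℙ down)) = refl
subdivide-multiplicity (shape 1ℙ up) (slot 1ℙ (shape 1ℙ up)) = refl
subdivide-multiplicity (shape 1ℙ up) (slot 1ℙ (shape 1ℙ down)) = refl
subdivide-multiplicity (shape 1ℙ down) (slot 0ℙ (shape 0ℙ up)) = refl
subdivide-multiplicity (shape 1ℙ down) (slot 0ℙ (shape 0ℙ down)) = refl
subdivide-multiplicity (shape 1ℙ down) (slot 0ℙ (shape 1ℙ up)) = refl
subdivide-multiplicity (shape 1ℙ down) (slot 0ℙ (shape 1ℙ down)) = refl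
subdivide-multiplicity (shape 1ℙ down) (slot 1ℙ (shape 0ℙ up)) = refl
subdivide-multiplicity (shape 1ℙ down) (slot 1ℙ (shape 0ℙ down)) = refl
subdivide-multiplicity (shape 1ℙ down) (slot 1ℙ (shape 1ℙ up)) = refl
subdivide-multiplicity (shape 1ℙ down) (slot 1ℙ (shape 1ℙ down)) = refl

refine-multiplicity : ∀ e r σ →
  ∑< 4 (λ j → δᵉ (refine e j) (place r σ)) ≡
  δᵉ e (edge r (proj₁ (parents σ))) + δᵉ e (edge r (proj₂ (parents σ)))
refine-multiplicity (edge s h) r σ = begin
  ∑< 4 (λ j → δᵉ (place s (subdivide h j)) (place r σ))
    ≡⟨ ∑<-cong 4 (λ j _ → δᵉ-place s r (subdivide h j) σ) ⟩
  ∑< 4 (λ j → δ s r * δˢ (subdivide h j) σ)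
    ≡⟨ ∑<-*ˡ 4 (δ s r) (λ j → δˢ (subdivide h j) σ) ⟩
  δ s r * ∑< 4 (λ j → δˢ (subdivide h j) σ)
    ≡⟨ cong (δ s r *_) (subdivide-multiplicity h σ) ⟩
  δ s r * (δʰ h (proj₁ (parents σ)) + δʰ h (proj₂ (parents σ)))
    ≡⟨ *-distribˡ-+ (δ s r) _ _ ⟩
  δ s r * δʰ h (proj₁ (parents σ)) + δ s r * δʰ h (proj₂ (parents σ)) ∎

visits : ℕ → Edge → ℕ
visits N e = ∑< N (λ n → δᵉ (step n) e)

visits-×4 : ∀ N r σ →
  visits (N * 4) (place r σ) ≡ visits N (edge r (proj₁ (parents σ))) + visits N (edge r (proj₂ (parents σ)))
visits-×4 N r σ = begin
  ∑< (N * 4) (λ n → δᵉ (step n) (place r σ))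
    ≡⟨ ∑<-blocks N 4 _ ⟩
  ∑< N (λ q → ∑< 4 (λ j → δᵉ (step (j + q * 4)) (place r σ)))
    ≡⟨ ∑<-cong N (λ q _ → ∑<-cong 4 λ j j<4 → cong (λ e → δᵉ e (place r σ)) (step-block q j j<4)) ⟩
  ∑< N (λ q → ∑< 4 (λ j → δᵉ (refine (step q) j) (place r σ)))
    ≡⟨ ∑<-cong N (λ q _ → refine-multiplicity (step q) r σ) ⟩
  ∑< N (λ q → δᵉ (step q) (edge r (proj₁ (parents σ))) + δᵉ (step q) (edge r (proj₂ (parents σ))))
    ≡⟨ ∑<-+ N _ _ ⟩
  visits N (edge r (proj₁ (parents σ))) + visits N (edge r (proj₂ (parents σ))) ∎

visits-×4-formula : ∀ {N} (F F′ : Edge → ℕ) → (∀ e → visits N e ≡ F e) →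
  (∀ r σ → F (edge r (proj₁ (parents σ))) + F (edge r (proj₂ (parents σ))) ≡ F′ (place r σ)) →
  ∀ e → visits (N * 4) e ≡ F′ e
visits-×4-formula {N} F F′ visits≡F F′-parents (edge s h) =
  subst (λ s → visits (N * 4) (edge s h) ≡ F′ (edge s h)) (bit-parity+⌊/2⌋*2 s)
    (trans (visits-×4 N r σ) (trans (cong₂ _+_ (visits≡F _) (visits≡F _)) (F′-parents r σ)))
  where
  r = ⌊ s /2⌋
  σ = slot (parity s) h

∸-double : ∀ L a → (L ∸ a) + (L ∸ a) ≡ L * 2 ∸ a * 2
∸-double L zero = +≡*2 L
∸-double zero (suc a) = refl
∸-double (suc L) (suc a) = ∸-double L a

∸-double+1 : ∀ L a → (L ∸ a) + (L ∸ suc a) ≡ L * 2 ∸ suc (a * 2)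
∸-double+1 zero zero = refl
∸-double+1 zero (suc a) = refl
∸-double+1 (suc L) zero = cong suc (+≡*2 L)
∸-double+1 (suc L) (suc a) = ∸-double+1 L a

source-parents : ∀ L r σ →
  (L ∸ source (edge r (proj₁ (parents σ)))) + (L ∸ source (edge r (proj₂ (parents σ)))) ≡ L * 2 ∸ source (place r σ)
source-parents L r (slot 0ℙ (shape 0ℙ up)) = ∸-double L (r * 2)
source-parents L r (slot 0ℙ (shape 0ℙ down)) = ∸-double+1 L (r * 2)
source-parents L r (slot 0ℙ (shape 1ℙ up)) = ∸-double+1 L (r * 2)
source-parents L r (slot 0ℙ (shape 1ℙ down)) = ∸-double L (suc (r * 2))
source-parents L r (slot 1ℙ (shape 0ℙ up)) = ∸-double L (suc (r * 2))
source-parents L r (slot 1ℙ (shape 0ℙ down)) = ∸-double+1 L (suc (r * 2))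
source-parents L r (slot 1ℙ (shape 1ℙ up)) = ∸-double+1 L (suc (r * 2))
source-parents L r (slot 1ℙ (shape 1ℙ down)) = ∸-double L (suc (suc (r * 2)))

⌈low/2⌉ : Edge → ℕ
⌈low/2⌉ (edge s (shape p _)) = bit p + s

⌈low/2⌉-parents : ∀ K r σ →
  (K ∸ ⌈low/2⌉ (edge r (proj₁ (parents σ)))) + (K ∸ ⌈low/2⌉ (edge r (proj₂ (parents σ)))) ≡ K * 2 ∸ ⌈low/2⌉ (place r σ)
⌈low/2⌉-parents K r (slot 0ℙ (shape 0ℙ up)) = ∸-double K r
⌈low/2⌉-parents K r (slot 0ℙ (shape 0ℙ down)) = ∸-double K r
⌈low/2⌉-parents K r (slot 0ℙ (shape 1ℙ up)) = ∸-double+1 K r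
⌈low/2⌉-parents K r (slot 0ℙ (shape 1ℙ down)) = trans (+-comm (K ∸ suc r) (K ∸ r)) (∸-double+1 K r)
⌈low/2⌉-parents K r (slot 1ℙ (shape 0ℙ up)) = trans (+-comm (K ∸ suc r) (K ∸ r)) (∸-double+1 K r)
⌈low/2⌉-parents K r (slot 1ℙ (shape 0ℙ down)) = ∸-double+1 K r
⌈low/2⌉-parents K r (slot 1ℙ (shape 1ℙ up)) = ∸-double K (suc r)
⌈low/2⌉-parents K r (slot 1ℙ (shape 1ℙ down)) = ∸-double K (suc r)

visits-1 : ∀ e → visits 1 e ≡ 1 ∸ source e
visits-1 (edge zero (shape 0ℙ up)) = refl
visits-1 (edge zero (shape 0ℙ down)) = refl
visits-1 (edge zero (shape 1ℙ up)) = refl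
visits-1 (edge zero (shape 1ℙ down)) = refl
visits-1 (edge (suc s) (shape 0ℙ up)) = refl
visits-1 (edge (suc s) (shape 0ℙ down)) = refl
visits-1 (edge (suc s) (shape 1ℙ up)) = refl
visits-1 (edge (suc s) (shape 1ℙ down)) = refl

visits-2 : ∀ e → visits 2 e ≡ 1 ∸ ⌈low/2⌉ e
visits-2 (edge zero (shape 0ℙ up)) = refl
visits-2 (edge zero (shape 0ℙ down)) = refl
visits-2 (edge zero (shape 1ℙ up)) = refl
visits-2 (edge zero (shape 1ℙ down)) = refl
visits-2 (edge (suc s) (shape 0ℙ up)) = sym (0∸n≡0 s)
visits-2 (edge (suc s) (shape 0ℙ down)) = sym (0∸n≡0 s)
visits-2 (edge (suc s) (shape 1ℙ up)) = refl
visits-2 (edge (suc s) (shape 1ℙ down)) = refl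

visits-4^m : ∀ m e → visits (4 ^ m) e ≡ 2 ^ m ∸ source e
visits-4^m zero = visits-1
visits-4^m (suc m) e = begin
  visits (4 ^ suc m) e   ≡⟨ cong (λ N → visits N e) (*-comm 4 (4 ^ m)) ⟩
  visits (4 ^ m * 4) e   ≡⟨ visits-×4-formula {4 ^ m} _ _ (visits-4^m m) (source-parents (2 ^ m)) e ⟩
  2 ^ m * 2 ∸ source e   ≡⟨ cong (_∸ source e) (*-comm (2 ^ m) 2) ⟩
  2 ^ suc m ∸ source e   ∎

visits-4^m*2 : ∀ m e → visits (4 ^ m * 2) e ≡ 2 ^ m ∸ ⌈low/2⌉ e
visits-4^m*2 zero = visits-2
visits-4^m*2 (suc m) e = begin
  visits (4 ^ suc m * 2) e     ≡⟨ cong (λ N → visits N e) (reassoc (4 ^ m)) ⟩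
  visits (4 ^ m * 2 * 4) e     ≡⟨ visits-×4-formula {4 ^ m * 2} _ _ (visits-4^m*2 m) (⌈low/2⌉-parents (2 ^ m)) e ⟩
  2 ^ m * 2 ∸ ⌈low/2⌉ e        ≡⟨ cong (_∸ ⌈low/2⌉ e) (*-comm (2 ^ m) 2) ⟩
  2 ^ suc m ∸ ⌈low/2⌉ e        ∎
  where
  reassoc : ∀ x → 4 * x * 2 ≡ x * 2 * 4
  reassoc x = trans (cong (_* 2) (*-comm 4 x)) (trans (*-assoc x 4 2) (sym (*-assoc x 2 4)))

edgeAt : ℕ → Dir → Edge
edgeAt w d = edge ⌊ w /2⌋ (shape (parity w) d)

δᵉ-low : ∀ e e′ → δᵉ e e′ ≡ δ (low e) (low e′) * χ (dir e ≟ᵈ dir e′)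
δᵉ-low (edge s (shape p d)) (edge s′ (shape p′ d′)) =
  sym (trans (cong (_* χ (d ≟ᵈ d′)) (δ-bit+*2 p s p′ s′)) (*-assoc (δ s s′) _ _))

δᵉ-edgeAt : ∀ e w d → δᵉ e (edgeAt w d) ≡ δ (low e) w * χ (dir e ≟ᵈ d)
δᵉ-edgeAt e w d = trans (δᵉ-low e (edgeAt w d)) (cong (λ x → δ (low e) x * χ (dir e ≟ᵈ d)) (bit-parity+⌊/2⌋*2 w))

δ-target-zero : ∀ e → δ (target e) 0 ≡ δᵉ e (edgeAt 0 down)
δ-target-zero e@(edge _ (shape _ up)) = sym (trans (δᵉ-edgeAt e 0 down) (*-zeroʳ (δ (low e) 0)))
δ-target-zero e@(edge _ (shape _ down)) = sym (trans (δᵉ-edgeAt e 0 down) (*-identityʳ (δ (low e) 0)))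

δ-target-suc : ∀ e v → δ (target e) (suc v) ≡ δᵉ e (edgeAt v up) + δᵉ e (edgeAt (suc v) down)
δ-target-suc e@(edge _ (shape _ up)) v = sym (begin
  δᵉ e (edgeAt v up) + δᵉ e (edgeAt (suc v) down)  ≡⟨ cong₂ _+_ (δᵉ-edgeAt e v up) (δᵉ-edgeAt e (suc v) down) ⟩
  δ (low e) v * 1 + δ (low e) (suc v) * 0         ≡⟨ cong₂ _+_ (*-identityʳ (δ (low e) v)) (*-zeroʳ (δ (low e) (suc v))) ⟩
  δ (low e) v + 0                                 ≡⟨ +-identityʳ _ ⟩
  δ (low e) v                                     ∎)
δ-target-suc e@(edge _ (shape _ down)) v = sym (begin
  δᵉ e (edgeAt v up) + δᵉ e (edgeAt (suc v) down)  ≡⟨ cong₂ _+_ (δᵉ-edgeAt e v up) (δᵉ-edgeAt e (suc v) down) ⟩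
  δ (low e) v * 0 + δ (low e) (suc v) * 1         ≡⟨ cong₂ _+_ (*-zeroʳ (δ (low e) v)) (*-identityʳ (δ (low e) (suc v))) ⟩
  δ (low e) (suc v)                               ∎)

count-suc : ∀ N v → count (suc N) v ≡ count N v + χ (t N ℤ.≟ v)
count-suc N v = begin
  length (filter t≟v (upTo (suc N)))                  ≡⟨ cong (λ ns → length (filter t≟v ns)) (List.upTo-∷ʳ N) ⟨
  length (filter t≟v (upTo N ++ N ∷ []))              ≡⟨ cong length (List.filter-++ t≟v (upTo N) (N ∷ [])) ⟩
  length (filter t≟v (upTo N) ++ filter t≟v (N ∷ [])) ≡⟨ List.length-++ (filter t≟v (upTo N)) ⟩
  count N v + length (filter t≟v (N ∷ []))            ≡⟨ cong (λ x → count N v + x) singleton ⟩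
  count N v + χ (t N ℤ.≟ v)                           ∎
  where
  t≟v = λ n → t n ℤ.≟ v
  singleton : length (filter t≟v (N ∷ [])) ≡ χ (t N ℤ.≟ v)
  singleton with does (t N ℤ.≟ v)
  ... | true = refl
  ... | false = refl

count≡∑δ-target : ∀ N k → count N (+ k) ≡ ∑< N (λ n → δ (target (step n)) k)
count≡∑δ-target zero k = refl
count≡∑δ-target (suc N) k = trans (count-suc N (+ k))
  (cong₂ _+_ (count≡∑δ-target N k) (cong (λ x → χ (x ℤ.≟ + k)) (t≡target-step N)))

count-at-0 : ∀ N → count N (+ 0) ≡ visits N (edgeAt 0 down)
count-at-0 N = trans (count≡∑δ-target N 0) (∑<-cong N λ n _ → δ-target-zero (step n))

count-at-suc : ∀ N v → count N (+ suc v) ≡ visits N (edgeAt v up) + visits N (edgeAt (suc v) down)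
count-at-suc N v =
  trans (count≡∑δ-target N (suc v)) (trans (∑<-cong N λ n _ → δ-target-suc (step n) v) (∑<-+ N _ _))

∸-halves : ∀ K n → (K ∸ ⌊ n /2⌋) + (K ∸ ⌈ n /2⌉) ≡ K * 2 ∸ n
∸-halves K zero = +≡*2 K
∸-halves zero (suc zero) = refl
∸-halves (suc K) (suc zero) = cong suc (+≡*2 K)
∸-halves zero (suc (suc n)) = refl
∸-halves (suc K) (suc (suc n)) = ∸-halves K n

∸-neighbours : ∀ L v → suc v < L → (L ∸ v) + (L ∸ suc (suc v)) ≡ (L ∸ suc v) * 2
∸-neighbours (suc (suc w)) zero _ = cong suc (cong suc (+≡*2 w))
∸-neighbours (suc L) (suc v) (s≤s v<L) = ∸-neighbours L v v<L

∸-top : ∀ w → (suc w ∸ w) + (suc w ∸ suc (suc w)) ≡ 1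
∸-top zero = refl
∸-top (suc w) = ∸-top w

count-4^m-at-0 : ∀ m → count (4 ^ m) (+ 0) ≡ 2 ^ m ∸ 1
count-4^m-at-0 m = trans (count-at-0 (4 ^ m)) (visits-4^m m (edgeAt 0 down))

count-4^m-at-suc : ∀ m v → count (4 ^ m) (+ suc v) ≡ (2 ^ m ∸ v) + (2 ^ m ∸ suc (suc v))
count-4^m-at-suc m v = begin
  count (4 ^ m) (+ suc v)
    ≡⟨ count-at-suc (4 ^ m) v ⟩
  visits (4 ^ m) (edgeAt v up) + visits (4 ^ m) (edgeAt (suc v) down)
    ≡⟨ cong₂ _+_ (visits-4^m m (edgeAt v up)) (visits-4^m m (edgeAt (suc v) down)) ⟩
  (2 ^ m ∸ low (edgeAt v up)) + (2 ^ m ∸ suc (low (edgeAt (suc v) down)))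
    ≡⟨ cong₂ (λ x y → (2 ^ m ∸ x) + (2 ^ m ∸ suc y)) (bit-parity+⌊/2⌋*2 v) (bit-parity+⌊/2⌋*2 (suc v)) ⟩
  (2 ^ m ∸ v) + (2 ^ m ∸ suc (suc v)) ∎

count-4^m-at-2^m : ∀ m → count (4 ^ m) (+ (2 ^ m)) ≡ 1
count-4^m-at-2^m m with 2 ^ m | m^n>0 2 m | count-4^m-at-suc m
... | suc w | _ | count-at-suc-w = trans (count-at-suc-w w) (∸-top w)

count-4^m-at-k : ∀ m k → 1 ≤ k → k < 2 ^ m → count (4 ^ m) (+ k) ≡ 2 * (2 ^ m ∸ k)
count-4^m-at-k m (suc v) _ 1+v<2^m = begin
  count (4 ^ m) (+ suc v)                 ≡⟨ count-4^m-at-suc m v ⟩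
  (2 ^ m ∸ v) + (2 ^ m ∸ suc (suc v))     ≡⟨ ∸-neighbours (2 ^ m) v 1+v<2^m ⟩
  (2 ^ m ∸ suc v) * 2                     ≡⟨ *-comm (2 ^ m ∸ suc v) 2 ⟩
  2 * (2 ^ m ∸ suc v)                     ∎

4^[1+m]/2≡4^m*2 : ∀ m → 4 ^ suc m / 2 ≡ 4 ^ m * 2
4^[1+m]/2≡4^m*2 m = trans (cong (_/ 2) (trans (*-comm 4 (4 ^ m)) (*4≡*2*2 (4 ^ m)))) (m*n/n≡m (4 ^ m * 2) 2)

count-half-at-0 : ∀ m → count (4 ^ suc m / 2) (+ 0) ≡ 2 ^ m
count-half-at-0 m = begin
  count (4 ^ suc m / 2) (+ 0)             ≡⟨ cong (λ N → count N (+ 0)) (4^[1+m]/2≡4^m*2 m) ⟩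
  count (4 ^ m * 2) (+ 0)                 ≡⟨ count-at-0 (4 ^ m * 2) ⟩
  visits (4 ^ m * 2) (edgeAt 0 down)      ≡⟨ visits-4^m*2 m (edgeAt 0 down) ⟩
  2 ^ m                                   ∎

count-half-at-k : ∀ m k → 1 ≤ k → count (4 ^ suc m / 2) (+ k) ≡ 2 ^ suc m ∸ k
count-half-at-k m (suc v) _ = begin
  count (4 ^ suc m / 2) (+ suc v)
    ≡⟨ cong (λ N → count N (+ suc v)) (4^[1+m]/2≡4^m*2 m) ⟩
  count N (+ suc v)
    ≡⟨ count-at-suc N v ⟩
  visits N (edgeAt v up) + visits N (edgeAt (suc v) down)
    ≡⟨ cong₂ _+_ (visits-4^m*2 m (edgeAt v up)) (visits-4^m*2 m (edgeAt (suc v) down)) ⟩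
  (2 ^ m ∸ ⌈low/2⌉ (edgeAt v up)) + (2 ^ m ∸ ⌈low/2⌉ (edgeAt (suc v) down))
    ≡⟨ cong₂ (λ x y → (2 ^ m ∸ x) + (2 ^ m ∸ y)) (bit-parity+⌊/2⌋ v) (bit-parity+⌊/2⌋ (suc v)) ⟩
  (2 ^ m ∸ ⌊ suc v /2⌋) + (2 ^ m ∸ ⌈ suc v /2⌉)
    ≡⟨ ∸-halves (2 ^ m) (suc v) ⟩
  2 ^ m * 2 ∸ suc v
    ≡⟨ cong (_∸ suc v) (*-comm (2 ^ m) 2) ⟩
  2 ^ suc m ∸ suc v ∎
  where N = 4 ^ m * 2

theorem28 : ((m : ℕ) → 1 ≤ m →
                 (count ((4 ^ m) / 2) (+ 0) ≡ 2 ^ (m ∸ 1))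
                 × ((k : ℕ) → 1 ≤ k → k < 2 ^ m → count ((4 ^ m) / 2) (+ k) ≡ 2 ^ m ∸ k))
              × ((m : ℕ) →
                 (count (4 ^ m) (+ 0) ≡ 2 ^ m ∸ 1)
                 × (count (4 ^ m) (+ (2 ^ m)) ≡ 1)
                 × ((k : ℕ) → 1 ≤ k → k < 2 ^ m → count (4 ^ m) (+ k) ≡ 2 * (2 ^ m ∸ k)))
theorem28 =
  (λ where (suc m) _ → count-half-at-0 m , λ k 1≤k _ → count-half-at-k m k 1≤k) ,
  (λ m → count-4^m-at-0 m , count-4^m-at-2^m m , count-4^m-at-k m)
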